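{- For every finite Heyting algebra $H$, either $\mathrm{ds}_H(p \vee \neg p = \top) = 1$ or $\mathrm{ds}_H(p \vee \neg p = \top) \leq \frac{2}{3}$. That is, the equation $p \vee \neg p = \top$ has finite satisfiability gap $\frac{1}{3}$ in the class of Heyting algebras.
   Context: For a Heyting algebra $H$, $\neg x$ abbreviates $x \to \bot$. For a finite structure $M$ and a formula $\varphi(x_1,\dots,x_n)$, the degree of satisfiability $\mathrm{ds}_M(\varphi)$ is $|\{(a_1,\dots,a_n)\in M^n : M \models \varphi(a_1,\dots,a_n)\}| / |M|^n$. A formula $\varphi$ has finite satisfiability gap $\varepsilon>0$ in a theory $T$ if for every finite model $M$ of $T$, either $\mathrm{ds}_M(\varphi)=1$ or $\mathrm{ds}_M(\varphi)\le 1-\varepsilon$. -}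

module Defs where

open import Level using (Level)
open import Data.Nat using (ℕ)
open import Data.Fin using (Fin)
open import Data.List using (List; length; filter)
open import Data.List.Base using (allFin)
open import Data.Product using (∃)
open import Relation.Binary.PropositionalEquality using (_≡_)
open import Relation.Binary.Definitions using (Decidable)
open import Relation.Binary.Lattice.Bundles using (HeytingAlgebra)

-- A finite Heyting algebra: the carrier (modulo its setoid equality ≈)
-- is in bijection with Fin size via enum; equality is decidable
-- (automatic classically for a finite structure; needed constructively
-- to count satisfying assignments).
record IsFinite {c ℓ₁ ℓ₂ : Level} (H : HeytingAlgebra c ℓ₁ ℓ₂) : Set (c Level.⊔ ℓ₁) where
  open HeytingAlgebra H
  field
    size       : ℕ
    enum       : Fin size → Carrier
    enum-inj   : ∀ i j → enum i ≈ enum j → i ≡ j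
    enum-surj  : ∀ x → ∃ λ i → enum i ≈ x
    _≟_        : Decidable _≈_

module _ {c ℓ₁ ℓ₂ : Level} (H : HeytingAlgebra c ℓ₁ ℓ₂) where
  open HeytingAlgebra H

  neg : Carrier → Carrier
  neg x = x ⇨ ⊥

  -- number of p ∈ H with H ⊨ p ∨ ¬ p = ⊤
  -- (the numerator of ds_H(p ∨ ¬p = ⊤); the denominator is |H| = size)
  lemCount : IsFinite H → ℕ
  lemCount F = length (filter (λ i → (enum i ∨ neg (enum i)) ≟ ⊤) (allFin size))
    where open IsFinite F

module Submission where

-- If some a has a ∨ ¬a ≠ ⊤, put b = a ∨ ¬a; it is dense: ¬b = ⊥. Among the complemented
-- elements, negation maps those below b injectively to those not below b (a complemented x
-- with x ≤ b and ¬x ≤ b would force b = ⊤), and x ↦ x ∧ b maps those not below b injectively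
-- to non-complemented elements (b being dense, x ∧ b complemented forces x ≤ b). So the
-- complemented elements are at most twice as many as the others: at most 2/3 of the algebra.

open import Level using (Level)
open import Relation.Unary using (Pred)
open import Relation.Binary.Definitions using (_Respects_)
open import Relation.Binary.Lattice.Properties.MeetSemilattice using (≈-dec⇒≤-dec)
open import Relation.Binary.Lattice.Bundles using (HeytingAlgebra)

open import Defs

module _ {c ℓ₁ ℓ₂ : Level} (H : HeytingAlgebra c ℓ₁ ℓ₂) where

  open HeytingAlgebra H
  open import Relation.Binary.Lattice.Properties.HeytingAlgebra H
    using (¬_; x≤¬¬x; de-morgan₁; ⇨-eval; ⇨-applyʳ; ⇨-cong; ∧-distribˡ-∨-≤)
  open import Relation.Binary.Lattice.Properties.MeetSemilattice meetSemilattice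
    using (∧-monotonic)
  open import Relation.Binary.Lattice.Properties.JoinSemilattice joinSemilattice
    using (∨-cong)
  open import Relation.Binary.Reasoning.PartialOrder poset

  Complemented : Pred Carrier ℓ₁
  Complemented x = x ∨ ¬ x ≈ ⊤

  Dense : Pred Carrier ℓ₂
  Dense d = ¬ d ≤ ⊥

  complemented-resp-≈ : Complemented Respects _≈_
  complemented-resp-≈ x≈y x∨¬x≈⊤ =
    Eq.trans (∨-cong (Eq.sym x≈y) (⇨-cong (Eq.sym x≈y) Eq.refl)) x∨¬x≈⊤

  ¬-complemented : ∀ {x} → Complemented x → Complemented (¬ x)
  ¬-complemented {x} x∨¬x≈⊤ = antisym (maximum _) (begin
    ⊤          ≈⟨ x∨¬x≈⊤ ⟨
    x ∨ ¬ x    ≤⟨ ∨-least (trans (x≤¬¬x x) (y≤x∨y _ _)) (x≤x∨y _ _) ⟩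
    ¬ x ∨ ¬ ¬ x ∎)

  x≤y⇒¬x≤y⇒y≈⊤ : ∀ {x y} → Complemented x → x ≤ y → ¬ x ≤ y → y ≈ ⊤
  x≤y⇒¬x≤y⇒y≈⊤ x∨¬x≈⊤ x≤y ¬x≤y =
    antisym (maximum _) (trans (reflexive (Eq.sym x∨¬x≈⊤)) (∨-least x≤y ¬x≤y))

  complemented-cases : ∀ {w x y} → Complemented w → x ∧ w ≤ y → x ∧ ¬ w ≤ y → x ≤ y
  complemented-cases {w} {x} {y} w∨¬w≈⊤ x∧w≤y x∧¬w≤y = begin
    x                 ≤⟨ ∧-greatest refl (trans (maximum x) (reflexive (Eq.sym w∨¬w≈⊤))) ⟩
    x ∧ (w ∨ ¬ w)     ≤⟨ ∧-distribˡ-∨-≤ x w (¬ w) ⟩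
    x ∧ w ∨ x ∧ ¬ w   ≤⟨ ∨-least x∧w≤y x∧¬w≤y ⟩
    y                 ∎

  ¬-injective : ∀ {x y} → Complemented x → Complemented y → ¬ x ≈ ¬ y → x ≈ y
  ¬-injective cx cy ¬x≈¬y =
    antisym (¬-reflects-≤ cy (reflexive (Eq.sym ¬x≈¬y))) (¬-reflects-≤ cx (reflexive ¬x≈¬y))
    where
    ¬-reflects-≤ : ∀ {x y} → Complemented y → ¬ y ≤ ¬ x → x ≤ y
    ¬-reflects-≤ {x} {y} cy ¬y≤¬x = complemented-cases cy (x∧y≤y x y) (begin
      x ∧ ¬ y  ≤⟨ ∧-monotonic refl ¬y≤¬x ⟩
      x ∧ ¬ x  ≤⟨ ⇨-applyʳ refl ⟩
      ⊥        ≤⟨ minimum y ⟩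
      y        ∎)

  x∨¬x-dense : ∀ x → Dense (x ∨ ¬ x)
  x∨¬x-dense x = begin
    ¬ (x ∨ ¬ x)  ≈⟨ de-morgan₁ x (¬ x) ⟩
    ¬ x ∧ ¬ ¬ x  ≤⟨ ⇨-applyʳ refl ⟩
    ⊥            ∎

  module _ {d} (dense : Dense d) where

    ∧-dense-reflects-≤ : ∀ {x y} → Complemented y → x ∧ d ≤ y ∧ d → x ≤ y
    ∧-dense-reflects-≤ {x} {y} cy x∧d≤y∧d = complemented-cases cy (x∧y≤y x y) (begin
      x ∧ ¬ y  ≤⟨ transpose-⇨ (begin
        (x ∧ ¬ y) ∧ d   ≤⟨ ∧-greatest (trans (x∧y≤x _ _) (x∧y≤y _ _)) (∧-monotonic (x∧y≤x _ _) refl) ⟩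
        ¬ y ∧ (x ∧ d)   ≤⟨ ∧-monotonic refl (trans x∧d≤y∧d (x∧y≤x _ _)) ⟩
        ¬ y ∧ y         ≤⟨ ⇨-eval ⟩
        ⊥               ∎) ⟩
      ¬ d      ≤⟨ dense ⟩
      ⊥        ≤⟨ minimum y ⟩
      y        ∎)

    ∧-dense-injective : ∀ {x y} → Complemented x → Complemented y → x ∧ d ≈ y ∧ d → x ≈ y
    ∧-dense-injective cx cy x∧d≈y∧d =
      antisym (∧-dense-reflects-≤ cy (reflexive x∧d≈y∧d))
              (∧-dense-reflects-≤ cx (reflexive (Eq.sym x∧d≈y∧d)))

    x∧d-complemented⇒x≤d : ∀ {x} → Complemented (x ∧ d) → x ≤ d
    x∧d-complemented⇒x≤d {x} c = begin
      x      ≤⟨ ∧-dense-reflects-≤ c (∧-greatest refl (x∧y≤y x d)) ⟩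
      x ∧ d  ≤⟨ x∧y≤y x d ⟩
      d      ∎

-- Imported after the Heyting-algebra section, where _≤_, refl and trans would clash with the lattice's.
open import Function.Base using (_∘_)
open import Data.Nat.Base using (ℕ; suc; _+_; _*_; _≤_; z≤n; s≤s)
open import Data.Nat.Properties
  using (+-comm; +-suc; +-identityʳ; +-mono-≤; +-monoʳ-≤; *-distribˡ-+; ≤-trans; module ≤-Reasoning)
open import Data.Bool.Base using (true; false)
open import Data.Product.Base using (_,_; proj₁; proj₂)
open import Data.Sum.Base using (_⊎_; inj₁; inj₂)
open import Data.Fin.Base using (Fin)
open import Data.Fin.Properties using (all?; ¬∀⟶∃¬)
open import Data.List.Base using ([]; _∷_; length; filter; allFin)
open import Data.List.Properties using (filter-all; length-removeAt′; length-tabulate)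
open import Data.List.Membership.Propositional using (_∈_; _─_)
open import Data.List.Membership.Propositional.Properties using (∈-filter⁺; ∈-filter⁻; ∈-allFin)
open import Data.List.Relation.Unary.Any using (here; there)
import Data.List.Relation.Unary.All as All
open import Data.List.Relation.Unary.All.Properties using (tabulate⁺)
open import Data.List.Relation.Unary.AllPairs using (_∷_)
open import Data.List.Relation.Unary.Unique.Propositional using (Unique)
open import Data.List.Relation.Unary.Unique.Propositional.Properties using (filter⁺; allFin⁺)
open import Relation.Nullary.Decidable using (does; yes; no)
open import Relation.Nullary.Negation using (¬_; contradiction)
open import Relation.Unary using (Decidable)
open import Relation.Unary.Properties using (∁?; _∩?_)
open import Relation.Binary.PropositionalEquality using (_≡_; _≢_; refl; sym; trans; cong; subst)

module _ {a} {A : Set a} where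

  ∈-─⁺ : ∀ {x y : A} {ys} (x∈ys : x ∈ ys) → y ∈ ys → y ≢ x → y ∈ ys ─ x∈ys
  ∈-─⁺ (here refl)  (here refl)  y≢x = contradiction refl y≢x
  ∈-─⁺ (here refl)  (there y∈ys) _   = y∈ys
  ∈-─⁺ (there _)    (here refl)  _   = here refl
  ∈-─⁺ (there x∈ys) (there y∈ys) y≢x = there (∈-─⁺ x∈ys y∈ys y≢x)

module _ {a b} {A : Set a} {B : Set b} (f : A → B) where

  injectiveOn⇒length-≤ : ∀ {xs ys} → Unique xs → (∀ {x} → x ∈ xs → f x ∈ ys) →
    (∀ {x y} → x ∈ xs → y ∈ xs → f x ≡ f y → x ≡ y) → length xs ≤ length ys
  injectiveOn⇒length-≤ {[]}          _            _    _   = z≤n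
  injectiveOn⇒length-≤ {x ∷ xs} {ys} (x∉xs ∷ !xs) maps inj = begin
    suc (length xs)           ≤⟨ s≤s (injectiveOn⇒length-≤ !xs maps′ λ p q → inj (there p) (there q)) ⟩
    suc (length (ys ─ fx∈ys)) ≡⟨ length-removeAt′ ys _ ⟨
    length ys                 ∎
    where
    open ≤-Reasoning
    fx∈ys : f x ∈ ys
    fx∈ys = maps (here refl)
    maps′ : ∀ {y} → y ∈ xs → f y ∈ ys ─ fx∈ys
    maps′ y∈xs = ∈-─⁺ fx∈ys (maps (there y∈xs))
      λ fy≡fx → All.lookup x∉xs y∈xs (inj (here refl) (there y∈xs) (sym fy≡fx))

module _ {a p} {A : Set a} {P : Pred A p} (P? : Decidable P) where

  length-filter+filter-∁ : ∀ xs → length (filter P? xs) + length (filter (∁? P?) xs) ≡ length xs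
  length-filter+filter-∁ []       = refl
  length-filter+filter-∁ (x ∷ xs) with does (P? x)
  ... | true  = cong suc (length-filter+filter-∁ xs)
  ... | false = trans (+-suc _ _) (cong suc (length-filter+filter-∁ xs))

  length-filter-∩+filter-∩∁ : ∀ {q} {Q : Pred A q} (Q? : Decidable Q) xs →
    length (filter (P? ∩? Q?) xs) + length (filter (P? ∩? ∁? Q?) xs) ≡ length (filter P? xs)
  length-filter-∩+filter-∩∁ Q? []       = refl
  length-filter-∩+filter-∩∁ Q? (x ∷ xs) with does (P? x) | does (Q? x)
  ... | false | _     = length-filter-∩+filter-∩∁ Q? xs
  ... | true  | true  = cong suc (length-filter-∩+filter-∩∁ Q? xs)
  ... | true  | false = trans (+-suc _ _) (cong suc (length-filter-∩+filter-∩∁ Q? xs))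

module _ {c ℓ₁ ℓ₂ : Level} (H : HeytingAlgebra c ℓ₁ ℓ₂) (F : IsFinite H) where

  private
    module H = HeytingAlgebra H
  open IsFinite F

  count : ∀ {p} {P : Pred H.Carrier p} → Decidable P → ℕ
  count P? = length (filter (P? ∘ enum) (allFin size))

  -- Chosen so that lemCount H F is count complemented? by definition.
  complemented? : Decidable (Complemented H)
  complemented? x = (x H.∨ neg H x) ≟ H.⊤

  module _ {p} {P : Pred H.Carrier p} (P? : Decidable P) where

    count+count-∁ : count P? + count (∁? P?) ≡ size
    count+count-∁ = trans (length-filter+filter-∁ (P? ∘ enum) (allFin size)) (length-tabulate _)

    count-∩+count-∩∁ : ∀ {q} {Q : Pred H.Carrier q} (Q? : Decidable Q) →
      count (P? ∩? Q?) + count (P? ∩? ∁? Q?) ≡ count P?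
    count-∩+count-∩∁ Q? = length-filter-∩+filter-∩∁ (P? ∘ enum) (Q? ∘ enum) (allFin size)

    count-all : (∀ i → P (enum i)) → count P? ≡ size
    count-all all = trans (cong length (filter-all (P? ∘ enum) (tabulate⁺ all))) (length-tabulate _)

    injectiveOn⇒count-≤ : ∀ {q} {Q : Pred H.Carrier q} (Q? : Decidable Q) (f : H.Carrier → H.Carrier) →
      Q Respects H._≈_ → (∀ {x} → P x → Q (f x)) →
      (∀ {x y} → P x → P y → f x H.≈ f y → x H.≈ y) → count P? ≤ count Q?
    injectiveOn⇒count-≤ Q? f Q-resp maps inj =
      injectiveOn⇒length-≤ (index ∘ f ∘ enum) (filter⁺ (P? ∘ enum) (allFin⁺ size)) maps′ inj′
      where
      index : H.Carrier → Fin size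
      index x = proj₁ (enum-surj x)
      enum-index : ∀ x → enum (index x) H.≈ x
      enum-index x = proj₂ (enum-surj x)
      P-of : ∀ {i} → i ∈ filter (P? ∘ enum) (allFin size) → P (enum i)
      P-of i∈ = proj₂ (∈-filter⁻ (P? ∘ enum) {xs = allFin size} i∈)
      maps′ : ∀ {i} → i ∈ filter (P? ∘ enum) (allFin size) →
        index (f (enum i)) ∈ filter (Q? ∘ enum) (allFin size)
      maps′ i∈ = ∈-filter⁺ (Q? ∘ enum) (∈-allFin _) (Q-resp (H.Eq.sym (enum-index _)) (maps (P-of i∈)))
      inj′ : ∀ {i j} → i ∈ filter (P? ∘ enum) (allFin size) → j ∈ filter (P? ∘ enum) (allFin size) →
        index (f (enum i)) ≡ index (f (enum j)) → i ≡ j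
      inj′ {i} {j} i∈ j∈ eq = enum-inj i j (inj (P-of i∈) (P-of j∈)
        (H.Eq.trans (H.Eq.sym (enum-index _)) (H.Eq.trans (H.Eq.reflexive (cong enum eq)) (enum-index _))))

  count-complemented≤2*count-∁ : ∀ {a} → ¬ Complemented H a →
    count complemented? ≤ 2 * count (∁? complemented?)
  count-complemented≤2*count-∁ {a} a-not-complemented = begin
    count complemented?  ≡⟨ count-∩+count-∩∁ complemented? below? ⟨
    #below + #above      ≤⟨ +-mono-≤ (≤-trans below≤above above≤non) above≤non ⟩
    #non + #non          ≡⟨ cong (#non +_) (+-identityʳ #non) ⟨
    2 * #non             ∎
    where
    open ≤-Reasoning
    b : H.Carrier
    b = a H.∨ neg H a
    b-dense : Dense H b
    b-dense = x∨¬x-dense H a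
    below? : Decidable (H._≤ b)
    below? x = ≈-dec⇒≤-dec H.meetSemilattice _≟_ x b
    #below : ℕ
    #below = count (complemented? ∩? below?)
    #above : ℕ
    #above = count (complemented? ∩? ∁? below?)
    #non : ℕ
    #non = count (∁? complemented?)
    below≤above : #below ≤ #above
    below≤above = injectiveOn⇒count-≤ (complemented? ∩? below?) (complemented? ∩? ∁? below?) (neg H)
      (λ x≈y (cx , x≰b) → complemented-resp-≈ H x≈y cx , λ y≤b → x≰b (H.trans (H.reflexive x≈y) y≤b))
      (λ (cx , x≤b) → ¬-complemented H cx , λ ¬x≤b → a-not-complemented (x≤y⇒¬x≤y⇒y≈⊤ H cx x≤b ¬x≤b))
      (λ (cx , _) (cy , _) → ¬-injective H cx cy)
    above≤non : #above ≤ #non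
    above≤non = injectiveOn⇒count-≤ (complemented? ∩? ∁? below?) (∁? complemented?) (H._∧ b)
      (λ x≈y x-non cy → x-non (complemented-resp-≈ H (H.Eq.sym x≈y) cy))
      (λ (cx , x≰b) cx∧b → x≰b (x∧d-complemented⇒x≤d H b-dense cx∧b))
      (λ (cx , _) (cy , _) → ∧-dense-injective H b-dense cx cy)

m≤2n⇒3m≤2[m+n] : ∀ {m n} → m ≤ 2 * n → 3 * m ≤ 2 * (m + n)
m≤2n⇒3m≤2[m+n] {m} {n} m≤2n = begin
  3 * m          ≡⟨ +-comm m (2 * m) ⟩
  2 * m + m      ≤⟨ +-monoʳ-≤ (2 * m) m≤2n ⟩
  2 * m + 2 * n  ≡⟨ *-distribˡ-+ 2 m n ⟨
  2 * (m + n)    ∎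
  where open ≤-Reasoning

theorem2p4 : {c ℓ₁ ℓ₂ : Level} (H : HeytingAlgebra c ℓ₁ ℓ₂) (F : IsFinite H) →
    (lemCount H F ≡ IsFinite.size F) ⊎ (3 * lemCount H F ≤ 2 * IsFinite.size F)
theorem2p4 H F with all? (complemented? H F ∘ IsFinite.enum F)
... | yes all-complemented = inj₁ (count-all H F (complemented? H F) all-complemented)
... | no ¬all-complemented
  with _ , a-not-complemented ← ¬∀⟶∃¬ _ _ (complemented? H F ∘ IsFinite.enum F) ¬all-complemented
  = inj₂ (subst (λ n → 3 * lemCount H F ≤ 2 * n) (count+count-∁ H F (complemented? H F))
      (m≤2n⇒3m≤2[m+n] (count-complemented≤2*count-∁ H F a-not-complemented)))
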